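{- Let $H$ be a bipartite graph of diameter three and girth six which is not isomorphic to any pseudo sphere graph $S_t$. Then for every connected graph $G$ of order $n\ge 2$, $\dim_l(G\odot H)=n\cdot\delta_H$.
   Context: All graphs are finite and simple. For a connected graph $X$, $d_X(x,y)$ is the length of a shortest path between $x$ and $y$. A vertex $w$ distinguishes two vertices $x,y$ if $d_X(w,x)\ne d_X(w,y)$. A set $S\subseteq V(X)$ is a local metric generator for $X$ if every two adjacent vertices of $X$ are distinguished by some vertex of $S$; a local metric generator of minimum cardinality is a local metric basis, and its cardinality is the local metric dimension $\dim_l(X)$. For a graph $G$ of order $n$ with vertices $v_1,\dots,v_n$ and a graph $H$, the corona product $G\odot H$ is obtained from one copy of $G$ and $n$ disjoint copies $H_1,\dots,H_n$ of $H$ by joining $v_i$ by an edge to every vertex of $H_i$. $\delta_H$ denotes the minimum degree of $H$. For $t\ge 3$, the pseudo sphere graph (near pencil) $S_t$ is obtained by taking $t-1$ disjoint paths of order $4$, identifying one end vertex of each path into a single vertex $a$ and the other end vertices into a single vertex $b$. -}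

module Defs where

open import Data.Nat using (ℕ; zero; suc; _+_; _*_; _≤_; _≡ᵇ_)
open import Data.Bool using (Bool; true; false; T; _∧_; _∨_; not)
open import Data.Fin using (Fin; toℕ; splitAt; remQuot; inject₁; fromℕ; _≟_)
  renaming (zero to fzero; suc to fsuc)
open import Data.Fin.Subset using (Subset; _∈_; ∣_∣)
open import Data.Vec using (tabulate)
open import Data.Sum using (_⊎_; inj₁; inj₂)
open import Data.Product using (Σ; ∃; ∃-syntax; _×_; _,_; proj₁; proj₂)
open import Data.Empty using (⊥)
open import Relation.Nullary using (¬_)
open import Relation.Nullary.Decidable using (⌊_⌋)
open import Relation.Binary.PropositionalEquality using (_≡_; _≢_)
open import Function.Definitions using (Injective; Bijective)

record Graph : Set where
  field
    order : ℕ
    adj   : Fin order → Fin order → Bool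
open Graph public

IsSimple : Graph → Set
IsSimple G = (∀ x y → adj G x y ≡ adj G y x) × (∀ x → adj G x x ≡ false)

Adj : (G : Graph) → Fin (order G) → Fin (order G) → Set
Adj G x y = T (adj G x y)

data Walk (G : Graph) : Fin (order G) → Fin (order G) → ℕ → Set where
  here : ∀ {x} → Walk G x x 0
  step : ∀ {x y z k} → Adj G x y → Walk G y z k → Walk G x z (suc k)

Dist : (G : Graph) → Fin (order G) → Fin (order G) → ℕ → Set
Dist G x y k = Walk G x y k × (∀ m → Walk G x y m → k ≤ m)

Connected : Graph → Set
Connected G = ∀ x y → ∃[ k ] Walk G x y k

Diameter : Graph → ℕ → Set
Diameter G d = (∀ x y → ∃[ k ] (k ≤ d × Dist G x y k))
             × (∃[ x ] ∃[ y ] Dist G x y d)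

HasCycle : Graph → ℕ → Set
HasCycle G zero = ⊥
HasCycle G (suc k) =
  Σ (Fin (suc k) → Fin (order G)) λ f →
    Injective _≡_ _≡_ f
    × (∀ (i : Fin k) → Adj G (f (inject₁ i)) (f (fsuc i)))
    × Adj G (f (fromℕ k)) (f fzero)

Girth : Graph → ℕ → Set
Girth G g = (3 ≤ g × HasCycle G g) × (∀ L → 3 ≤ L → HasCycle G L → g ≤ L)

Bipartite : Graph → Set
Bipartite G = Σ (Fin (order G) → Bool) λ c → ∀ x y → Adj G x y → c x ≢ c y

degree : (G : Graph) → Fin (order G) → ℕ
degree G v = ∣ tabulate (adj G v) ∣

MinDegree : Graph → ℕ → Set
MinDegree G δ = (∀ v → δ ≤ degree G v) × (∃[ v ] degree G v ≡ δ)

Isomorphic : Graph → Graph → Set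
Isomorphic G H = Σ (Fin (order G) → Fin (order H)) λ f →
  Bijective _≡_ _≡_ f × (∀ x y → adj H (f x) (f y) ≡ adj G x y)

-- Pseudo sphere graph S_t on vertices 0..2t-1:
-- a = 0, b = 1, u_i = 2+2i, w_i = 3+2i (0 ≤ i ≤ t-2);
-- edges a–u_i, u_i–w_i, w_i–b (paths a,u_i,w_i,b of order 4).
evenᵇ : ℕ → Bool
evenᵇ zero = true
evenᵇ (suc n) = not (evenᵇ n)

edgeS : ℕ → ℕ → Bool
edgeS zero y = evenᵇ y ∧ (not (y ≡ᵇ 0))
edgeS (suc zero) y = not (evenᵇ y) ∧ (not (y ≡ᵇ 1))
edgeS (suc (suc x)) y = evenᵇ x ∧ (y ≡ᵇ suc (suc (suc x)))

pseudoSphere : ℕ → Graph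
pseudoSphere t = record
  { order = t + t
  ; adj = λ x y → edgeS (toℕ x) (toℕ y) ∨ edgeS (toℕ y) (toℕ x) }

-- Corona product G ⊙ H on Fin (n + n*m): first n vertices are G,
-- vertex (i , h) of copy H_i encoded via remQuot.
corona : Graph → Graph → Graph
corona G H = record { order = n + n * m ; adj = cadj }
  where
  n = order G
  m = order H
  eqᵇ : Fin n → Fin n → Bool
  eqᵇ i j = ⌊ i ≟ j ⌋
  cadj' : Fin n ⊎ Fin (n * m) → Fin n ⊎ Fin (n * m) → Bool
  cadj' (inj₁ a) (inj₁ b) = adj G a b
  cadj' (inj₁ a) (inj₂ q) = eqᵇ a (proj₁ (remQuot {n} m q))
  cadj' (inj₂ p) (inj₁ b) = eqᵇ (proj₁ (remQuot {n} m p)) b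
  cadj' (inj₂ p) (inj₂ q) =
    eqᵇ (proj₁ (remQuot {n} m p)) (proj₁ (remQuot {n} m q))
    ∧ adj H (proj₂ (remQuot {n} m p)) (proj₂ (remQuot {n} m q))
  cadj : Fin (n + n * m) → Fin (n + n * m) → Bool
  cadj x y = cadj' (splitAt n x) (splitAt n y)

_⊙_ : Graph → Graph → Graph
G ⊙ H = corona G H

Distinguishes : (X : Graph) → Fin (order X) → Fin (order X) → Fin (order X) → Set
Distinguishes X w x y = ∃[ k₁ ] ∃[ k₂ ] (Dist X w x k₁ × Dist X w y k₂ × k₁ ≢ k₂)

IsLocalMetricGenerator : (X : Graph) → Subset (order X) → Set
IsLocalMetricGenerator X S =
  ∀ x y → Adj X x y → ∃[ w ] (w ∈ S × Distinguishes X w x y)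

LocalMetricDim : Graph → ℕ → Set
LocalMetricDim X k =
  (∃[ S ] (IsLocalMetricGenerator X S × ∣ S ∣ ≡ k))
  × (∀ S → IsLocalMetricGenerator X S → k ≤ ∣ S ∣)

-- A local metric generator of G ⊙ H must contain, in every copy H_i, a vertex equal or
-- adjacent to an endpoint of each edge xy of H: a vertex outside H_i reaches H_i only
-- through v_i, so it sees (i,x) and (i,y) at the same distance, and a vertex of H_i far
-- from both is at distance 2 from both. Conversely such a "near edge cover" of H, copied
-- into every H_i, is a local metric generator (the edges at v_i are handled using a
-- second copy, which exists as n ≥ 2 and G is connected).
--
-- If H has no 3- or 4-cycles, a near edge cover D has at least δ_H elements: choose u ∉ D
-- such that every neighbour of u has an element of D in its closed neighbourhood (a vertex
-- with no element of D in its closed neighbourhood has this property because of its edges;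
-- if every vertex is dominated by D, any u ∉ D does; if there is no u ∉ D, D is everything).
-- Distinct neighbours of u then get distinct elements of D. If H is bipartite of diameter 3,
-- the neighbourhood of any vertex v is a near edge cover, since the two endpoints of an edge
-- cannot both be at distance 3 from v. Taking v of minimum degree gives dim_l = n δ_H.

module Submission where

open import Defs
open import Data.Nat using (ℕ; zero; suc; _+_; _*_; _≤_; _<_; z≤n; s≤s)
open import Data.Nat.Properties
  using (≤-trans; ≤-antisym; ≮⇒≥; <⇒≱; +-mono-≤; m≤n+m; 1+n≢n; anyUpTo?; module ≤-Reasoning)
open import Data.Nat.Induction using (<-rec)
open import Data.Nat.GeneralisedArithmetic using (iterate)
open import Data.Bool using (Bool; true; false; T; not)
open import Data.Bool.Properties using (T-≡; T-∧; ¬-not)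
open import Data.Fin using (Fin; _≟_; punchIn; splitAt; remQuot; combine; join; _↑ˡ_; _↑ʳ_)
  renaming (zero to fzero; suc to fsuc)
open import Data.Fin.Properties
  using (any?; suc-injective; 0≢1+n; punchInᵢ≢i; splitAt-↑ˡ; splitAt-↑ʳ; remQuot-combine; combine-remQuot; join-splitAt)
open import Data.Fin.Subset using (Subset; _∈_; _∉_; ∣_∣; _-_; inside; outside)
open import Data.Fin.Subset.Properties
  using (_∈?_; x∈p∧x≢y⇒x∈p-y; x∈p⇒∣p-x∣<∣p∣; p─q⊆p; p⊆q⇒∣p∣≤∣q∣; Empty-unique; ∣⊥∣≡0)
open import Data.Vec using (_∷_; []; tabulate; lookup; here; there)
open import Data.Vec.Properties using (lookup∘tabulate; tabulate∘lookup; tabulate-cong; []=⇒lookup; lookup⇒[]=)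
open import Data.Sum using (_⊎_; inj₁; inj₂; [_,_]′)
import Data.Sum as Sum
open import Data.Sum.Properties using (inj₂-injective)
open import Data.Product using (∃-syntax; _×_; _,_; proj₁; proj₂)
open import Data.Empty using (⊥; ⊥-elim)
open import Function using (id; _∘_; Equivalence)
open import Relation.Nullary using (¬_; Dec; yes; no)
open import Relation.Nullary.Decidable using (T?; _×-dec_; _⊎-dec_; ¬?; decidable-stable; toWitness; fromWitness)
open import Relation.Binary.PropositionalEquality
  using (_≡_; _≢_; refl; sym; trans; cong; cong₂; subst; subst₂; ≢-sym; module ≡-Reasoning)

-- Counting subsets of Fin n

∈-tabulate⁺ : ∀ {n} {f : Fin n → Bool} {x} → T (f x) → x ∈ tabulate f
∈-tabulate⁺ {f = f} {x} fx = lookup⇒[]= x _ (trans (lookup∘tabulate f x) (Equivalence.to T-≡ fx))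

∈-tabulate⁻ : ∀ {n} {f : Fin n → Bool} {x} → x ∈ tabulate f → T (f x)
∈-tabulate⁻ {f = f} {x} x∈ = Equivalence.from T-≡ (trans (sym (lookup∘tabulate f x)) ([]=⇒lookup x∈))

∈⇒T-lookup : ∀ {n} {p : Subset n} {x} → x ∈ p → T (lookup p x)
∈⇒T-lookup x∈p = Equivalence.from T-≡ ([]=⇒lookup x∈p)

∣tabulate∣≡0 : ∀ {n} (f : Fin n → Bool) → (∀ x → ¬ T (f x)) → ∣ tabulate f ∣ ≡ 0
∣tabulate∣≡0 {n} f none = trans (cong ∣_∣ (Empty-unique λ (x , x∈) → none x (∈-tabulate⁻ x∈))) (∣⊥∣≡0 n)

∣tabulate∣-↑ : ∀ m {n} (f : Fin (m + n) → Bool) →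
  ∣ tabulate f ∣ ≡ ∣ tabulate (λ i → f (i ↑ˡ n)) ∣ + ∣ tabulate (λ j → f (m ↑ʳ j)) ∣
∣tabulate∣-↑ zero    f = refl
∣tabulate∣-↑ (suc m) f with f fzero
... | true  = cong suc (∣tabulate∣-↑ m (f ∘ fsuc))
... | false = ∣tabulate∣-↑ m (f ∘ fsuc)

∣tabulate∣-combine : ∀ m {n} (f : Fin (m * n) → Bool) {c} →
  (∀ (i : Fin m) → ∣ tabulate (f ∘ combine i) ∣ ≡ c) → ∣ tabulate f ∣ ≡ m * c
∣tabulate∣-combine zero    f blocks = refl
∣tabulate∣-combine (suc m) {n} f blocks =
  trans (∣tabulate∣-↑ n f)
        (cong₂ _+_ (blocks fzero) (∣tabulate∣-combine m (λ j → f (n ↑ʳ j)) (blocks ∘ fsuc)))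

∣tabulate∣-combine≥ : ∀ m {n} (f : Fin (m * n) → Bool) {c} →
  (∀ (i : Fin m) → c ≤ ∣ tabulate (f ∘ combine i) ∣) → m * c ≤ ∣ tabulate f ∣
∣tabulate∣-combine≥ zero    f blocks = z≤n
∣tabulate∣-combine≥ (suc m) {n} f blocks =
  subst (_ ≤_) (sym (∣tabulate∣-↑ n f))
        (+-mono-≤ (blocks fzero) (∣tabulate∣-combine≥ m (λ j → f (n ↑ʳ j)) (blocks ∘ fsuc)))

inject⇒∣p∣≤∣q∣ : ∀ {m n} (R : Fin m → Fin n → Set) {p : Subset m} {q : Subset n} →
  (∀ {x} → x ∈ p → ∃[ t ] (t ∈ q × R x t)) →
  (∀ {x y t} → x ∈ p → y ∈ p → t ∈ q → R x t → R y t → x ≡ y) →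
  ∣ p ∣ ≤ ∣ q ∣
inject⇒∣p∣≤∣q∣ R {[]} image injective = z≤n
inject⇒∣p∣≤∣q∣ R {outside ∷ p} image injective =
  inject⇒∣p∣≤∣q∣ (R ∘ fsuc) (image ∘ there)
    (λ x∈ y∈ t∈ Rx Ry → suc-injective (injective (there x∈) (there y∈) t∈ Rx Ry))
inject⇒∣p∣≤∣q∣ R {inside ∷ p} {q} image injective with image here
... | t₀ , t₀∈q , Rt₀ = ≤-trans (s≤s rest) (x∈p⇒∣p-x∣<∣p∣ t₀∈q)
  where
  rest : ∣ p ∣ ≤ ∣ q - t₀ ∣
  rest = inject⇒∣p∣≤∣q∣ (R ∘ fsuc) {q = q - t₀}
    (λ x∈ → let t , t∈q , Rt = image (there x∈) in
      t , x∈p∧x≢y⇒x∈p-y t∈q (λ { refl → 0≢1+n (injective here (there x∈) t∈q Rt₀ Rt) }) , Rt)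
    (λ x∈ y∈ t∈ Rx Ry → suc-injective (injective (there x∈) (there y∈) (p─q⊆p q _ t∈) Rx Ry))

-- Walks and distances

_▷_ : ∀ {G x y z k} → Walk G x y k → Adj G y z → Walk G x z (suc k)
here      ▷ e = step e here
step d w ▷ e = step d (w ▷ e)

Loopless : Graph → Set
Loopless G = ∀ x → ¬ Adj G x x

simple⇒loopless : ∀ {G} → IsSimple G → Loopless G
simple⇒loopless (_ , noLoops) x = subst T (noLoops x)

adj⇒≢ : ∀ {G} → Loopless G → ∀ {x y} → Adj G x y → x ≢ y
adj⇒≢ loopless e refl = loopless _ e

adj-sym : ∀ {G} → IsSimple G → ∀ {x y} → Adj G x y → Adj G y x
adj-sym (symmetric , _) {x} {y} = subst T (symmetric x y)

dist-unique : ∀ {G x y k k′} → Dist G x y k → Dist G x y k′ → k ≡ k′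
dist-unique (w , min) (w′ , min′) = ≤-antisym (min _ w′) (min′ _ w)

dist-refl : ∀ {G} x → Dist G x x 0
dist-refl x = here , λ _ _ → z≤n

dist-adj : ∀ {G} → Loopless G → ∀ {x y} → Adj G x y → Dist G x y 1
dist-adj loopless e = step e here , λ where
  zero    here → ⊥-elim (loopless _ e)
  (suc _) _    → s≤s z≤n

dist-2 : ∀ {G x y} → Walk G x y 2 → x ≢ y → ¬ Adj G x y → Dist G x y 2
dist-2 w x≢y ¬xy = w , λ where
  zero          here               → ⊥-elim (x≢y refl)
  (suc zero)    (step e here)      → ⊥-elim (¬xy e)
  (suc (suc _)) _                  → s≤s (s≤s z≤n)

walk? : ∀ G k x y → Dec (Walk G x y k)
walk? G zero    x y with x ≟ y
... | yes refl = yes here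
... | no  x≢y  = no λ { here → x≢y refl }
walk? G (suc k) x y with any? (λ z → T? (adj G x z) ×-dec walk? G k z y)
... | yes (_ , e , w) = yes (step e w)
... | no  ¬w          = no λ { (step e w) → ¬w (_ , e , w) }

walk⇒dist : ∀ {G x y k} → Walk G x y k → ∃[ d ] Dist G x y d
walk⇒dist {G} {x} {y} {k} = <-rec (λ k → Walk G x y k → ∃[ d ] Dist G x y d) shorten k
  where
  shorten : ∀ k → (∀ {j} → j < k → Walk G x y j → ∃[ d ] Dist G x y d) →
    Walk G x y k → ∃[ d ] Dist G x y d
  shorten k rec w with anyUpTo? (λ j → walk? G j x y) k
  ... | yes (j , j<k , w′) = rec j<k w′
  ... | no  ¬shorter       = k , w , λ j w′ → ≮⇒≥ (λ j<k → ¬shorter (j , j<k , w′))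

distinguishes-sym : ∀ {G w x y} → Distinguishes G w x y → Distinguishes G w y x
distinguishes-sym (k₁ , k₂ , d₁ , d₂ , k₁≢k₂) = k₂ , k₁ , d₂ , d₁ , k₁≢k₂ ∘ sym

-- Short cycles

TriangleFree : Graph → Set
TriangleFree H = ∀ {a b c} → Adj H a b → Adj H b c → Adj H c a → ⊥

SquareFree : Graph → Set
SquareFree H = ∀ {a b c d} → Adj H a b → Adj H b c → Adj H c d → Adj H d a → a ≢ c → b ≢ d → ⊥

girth>3⇒triangleFree : ∀ {H g} → IsSimple H → Girth H g → 3 < g → TriangleFree H
girth>3⇒triangleFree {H} simple girth 3<g {a} {b} {c} ab bc ca =
  <⇒≱ 3<g (proj₂ girth 3 (s≤s (s≤s (s≤s z≤n)))
    (f , injective , (λ { fzero → ab ; (fsuc fzero) → bc }) , ca))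
  where
  f : Fin 3 → Fin (order H)
  f fzero = a
  f (fsuc fzero) = b
  f (fsuc (fsuc fzero)) = c
  ne : ∀ {x y} → Adj H x y → x ≢ y
  ne = adj⇒≢ (simple⇒loopless simple)
  injective : ∀ {i j} → f i ≡ f j → i ≡ j
  injective {fzero}               {fzero}               _ = refl
  injective {fsuc fzero}          {fsuc fzero}          _ = refl
  injective {fsuc (fsuc fzero)}   {fsuc (fsuc fzero)}   _ = refl
  injective {fzero}               {fsuc fzero}          e = ⊥-elim (ne ab e)
  injective {fsuc fzero}          {fzero}               e = ⊥-elim (ne ab (sym e))
  injective {fsuc fzero}          {fsuc (fsuc fzero)}   e = ⊥-elim (ne bc e)
  injective {fsuc (fsuc fzero)}   {fsuc fzero}          e = ⊥-elim (ne bc (sym e))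
  injective {fsuc (fsuc fzero)}   {fzero}               e = ⊥-elim (ne ca e)
  injective {fzero}               {fsuc (fsuc fzero)}   e = ⊥-elim (ne ca (sym e))

girth>4⇒squareFree : ∀ {H g} → IsSimple H → Girth H g → 4 < g → SquareFree H
girth>4⇒squareFree {H} simple girth 4<g {a} {b} {c} {d} ab bc cd da a≢c b≢d =
  <⇒≱ 4<g (proj₂ girth 4 (s≤s (s≤s (s≤s z≤n)))
    (f , injective , (λ { fzero → ab ; (fsuc fzero) → bc ; (fsuc (fsuc fzero)) → cd }) , da))
  where
  f : Fin 4 → Fin (order H)
  f fzero = a
  f (fsuc fzero) = b
  f (fsuc (fsuc fzero)) = c
  f (fsuc (fsuc (fsuc fzero))) = d
  ne : ∀ {x y} → Adj H x y → x ≢ y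
  ne = adj⇒≢ (simple⇒loopless simple)
  injective : ∀ {i j} → f i ≡ f j → i ≡ j
  injective {fzero}                      {fzero}                      _ = refl
  injective {fsuc fzero}                 {fsuc fzero}                 _ = refl
  injective {fsuc (fsuc fzero)}          {fsuc (fsuc fzero)}          _ = refl
  injective {fsuc (fsuc (fsuc fzero))}   {fsuc (fsuc (fsuc fzero))}   _ = refl
  injective {fzero}                      {fsuc fzero}                 e = ⊥-elim (ne ab e)
  injective {fsuc fzero}                 {fzero}                      e = ⊥-elim (ne ab (sym e))
  injective {fzero}                      {fsuc (fsuc fzero)}          e = ⊥-elim (a≢c e)
  injective {fsuc (fsuc fzero)}          {fzero}                      e = ⊥-elim (a≢c (sym e))
  injective {fzero}                      {fsuc (fsuc (fsuc fzero))}   e = ⊥-elim (ne da (sym e))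
  injective {fsuc (fsuc (fsuc fzero))}   {fzero}                      e = ⊥-elim (ne da e)
  injective {fsuc fzero}                 {fsuc (fsuc fzero)}          e = ⊥-elim (ne bc e)
  injective {fsuc (fsuc fzero)}          {fsuc fzero}                 e = ⊥-elim (ne bc (sym e))
  injective {fsuc fzero}                 {fsuc (fsuc (fsuc fzero))}   e = ⊥-elim (b≢d e)
  injective {fsuc (fsuc (fsuc fzero))}   {fsuc fzero}                 e = ⊥-elim (b≢d (sym e))
  injective {fsuc (fsuc fzero)}          {fsuc (fsuc (fsuc fzero))}   e = ⊥-elim (ne cd e)
  injective {fsuc (fsuc (fsuc fzero))}   {fsuc (fsuc fzero)}          e = ⊥-elim (ne cd (sym e))

-- Near edge covers

neighbours : (G : Graph) → Fin (order G) → Subset (order G)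
neighbours G v = tabulate (adj G v)

Near : (G : Graph) → Fin (order G) → Fin (order G) → Set
Near G t x = t ≡ x ⊎ Adj G t x

near? : ∀ G t x → Dec (Near G t x)
near? G t x = (t ≟ x) ⊎-dec T? (adj G t x)

NearEdgeCover : (G : Graph) → Subset (order G) → Set
NearEdgeCover G D = ∀ x y → Adj G x y → ∃[ t ] (t ∈ D × (Near G t x ⊎ Near G t y))

walk-colour : ∀ {G} (c : Fin (order G) → Bool) → (∀ x y → Adj G x y → c x ≢ c y) →
  ∀ {x y k} → Walk G x y k → c y ≡ iterate not (c x) k
walk-colour c proper here = refl
walk-colour c proper {k = suc k} (step e w) =
  trans (walk-colour c proper w) (cong (λ b → iterate not b k) (¬-not (≢-sym (proper _ _ e))))

module _ {G : Graph} (simple : IsSimple G) where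

  private
    Witness : Fin (order G) → Fin (order G) → Fin (order G) → Set
    Witness v x y = ∃[ s ] (s ∈ neighbours G v × (Near G s x ⊎ Near G s y))

    witness-sym : ∀ {v x y} → Witness v x y → Witness v y x
    witness-sym (s , s∈ , near) = s , s∈ , [ inj₂ , inj₁ ]′ near

    close-or-3 : ∀ {v x y k} → Walk G v x k → k ≤ 3 → Adj G x y → Witness v x y ⊎ Walk G v x 3
    close-or-3 {y = y} here _ xy = inj₁ (y , ∈-tabulate⁺ xy , inj₂ (inj₁ refl))
    close-or-3 {x = x} (step vx here) _ _ = inj₁ (x , ∈-tabulate⁺ vx , inj₁ (inj₁ refl))
    close-or-3 (step vs (step sx here)) _ _ = inj₁ (_ , ∈-tabulate⁺ vs , inj₁ (inj₂ sx))
    close-or-3 w@(step _ (step _ (step _ here))) _ _ = inj₂ w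
    close-or-3 (step _ (step _ (step _ (step _ _)))) (s≤s (s≤s (s≤s ())))

  bipartite⇒neighbours-cover : Bipartite G → (∀ x y → ∃[ k ] (k ≤ 3 × Walk G x y k)) →
    ∀ v → NearEdgeCover G (neighbours G v)
  bipartite⇒neighbours-cover (c , proper) walks v x y xy
    with walks v x | walks v y
  ... | _ , kx≤3 , wx | _ , ky≤3 , wy
    with close-or-3 wx kx≤3 xy | close-or-3 wy ky≤3 (adj-sym simple xy)
  ... | inj₁ near | _         = near
  ... | inj₂ _    | inj₁ near = witness-sym near
  ... | inj₂ wx   | inj₂ wy   =
    ⊥-elim (proper x y xy (trans (walk-colour c proper wx) (sym (walk-colour c proper wy))))

  degree≤∣D∣ : TriangleFree G → SquareFree G → ∀ {D u} → u ∉ D →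
    (∀ y → Adj G u y → ∃[ t ] (t ∈ D × Near G t y)) → degree G u ≤ ∣ D ∣
  degree≤∣D∣ triangleFree squareFree {D} {u} u∉D near =
    inject⇒∣p∣≤∣q∣ (λ y t → Near G t y) (λ y∈ → near _ (∈-tabulate⁻ y∈)) injective
    where
    injective : ∀ {y y′ t} → y ∈ neighbours G u → y′ ∈ neighbours G u → t ∈ D →
      Near G t y → Near G t y′ → y ≡ y′
    injective _ _ _ (inj₁ refl) (inj₁ refl) = refl
    injective uy uy′ _ (inj₁ refl) (inj₂ yy′) =
      ⊥-elim (triangleFree (∈-tabulate⁻ uy) yy′ (adj-sym simple (∈-tabulate⁻ uy′)))
    injective uy uy′ _ (inj₂ y′y) (inj₁ refl) =
      ⊥-elim (triangleFree (∈-tabulate⁻ uy′) y′y (adj-sym simple (∈-tabulate⁻ uy)))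
    injective {y} {y′} uy uy′ t∈D (inj₂ ty) (inj₂ ty′) with y ≟ y′
    ... | yes y≡y′ = y≡y′
    ... | no  y≢y′ = ⊥-elim (squareFree (∈-tabulate⁻ uy) (adj-sym simple ty) ty′
                       (adj-sym simple (∈-tabulate⁻ uy′)) (λ { refl → u∉D t∈D }) y≢y′)

  private
    dominated? : ∀ D y → Dec (∃[ t ] (t ∈ D × Near G t y))
    dominated? D y = any? (λ t → (t ∈? D) ×-dec near? G t y)

  nearEdgeCover⇒δ≤∣D∣ : TriangleFree G → SquareFree G → ∀ {δ D} → (∀ u → δ ≤ degree G u) →
    Fin (order G) → NearEdgeCover G D → δ ≤ ∣ D ∣
  nearEdgeCover⇒δ≤∣D∣ triangleFree squareFree {δ} {D} minDegree z cover
    with any? (λ u → ¬? (dominated? D u))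
  ... | yes (u , ¬dominated) =
    ≤-trans (minDegree u) (degree≤∣D∣ triangleFree squareFree u∉D nearNeighbour)
    where
    u∉D : u ∉ D
    u∉D u∈D = ¬dominated (u , u∈D , inj₁ refl)
    nearNeighbour : ∀ y → Adj G u y → ∃[ t ] (t ∈ D × Near G t y)
    nearNeighbour y uy with cover u y uy
    ... | t , t∈D , inj₁ tu = ⊥-elim (¬dominated (t , t∈D , tu))
    ... | t , t∈D , inj₂ ty = t , t∈D , ty
  ... | no ¬undominated with any? (λ x → ¬? (x ∈? D))
  ...   | yes (x , x∉D) =
    ≤-trans (minDegree x) (degree≤∣D∣ triangleFree squareFree x∉D (λ y _ → dominated y))
    where
    dominated : ∀ y → ∃[ t ] (t ∈ D × Near G t y)
    dominated y = decidable-stable (dominated? D y) (λ ¬dominated → ¬undominated (y , ¬dominated))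
  ...   | no ¬outside =
    ≤-trans (minDegree z) (p⊆q⇒∣p∣≤∣q∣ {p = neighbours G z} λ {x} _ →
      decidable-stable (x ∈? D) (λ x∉D → ¬outside (x , x∉D)))

-- The corona product

∃-other : ∀ {k} → 2 ≤ k → (a : Fin k) → ∃[ j ] j ≢ a
∃-other {suc (suc _)} (s≤s (s≤s _)) a = punchIn a fzero , punchInᵢ≢i a fzero

module Corona (G H : Graph) where

  n : ℕ
  n = order G

  m : ℕ
  m = order H

  Vertex : Set
  Vertex = Fin n ⊎ (Fin n × Fin m)

  view : Fin (order (G ⊙ H)) → Vertex
  view x = Sum.map₂ (remQuot m) (splitAt n x)

  emb : Vertex → Fin (order (G ⊙ H))
  emb (inj₁ i)       = i ↑ˡ (n * m)
  emb (inj₂ (i , h)) = n ↑ʳ combine i h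

  view-emb : ∀ p → view (emb p) ≡ p
  view-emb (inj₁ i)       rewrite splitAt-↑ˡ n i (n * m) = refl
  view-emb (inj₂ (i , h))
    rewrite splitAt-↑ʳ n (n * m) (combine i h) | remQuot-combine {n} {m} i h = refl

  emb-view : ∀ x → emb (view x) ≡ x
  emb-view x with splitAt n x in eq
  ... | inj₁ i = trans (cong (join n (n * m)) (sym eq)) (join-splitAt n (n * m) x)
  ... | inj₂ q = trans (cong (n ↑ʳ_) (combine-remQuot {n} m q))
                       (trans (cong (join n (n * m)) (sym eq)) (join-splitAt n (n * m) x))

  vG : Fin n → Fin (order (G ⊙ H))
  vG i = emb (inj₁ i)

  vH : Fin n → Fin m → Fin (order (G ⊙ H))
  vH i h = emb (inj₂ (i , h))

  Adjᵛ : Vertex → Vertex → Set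
  Adjᵛ (inj₁ i)       (inj₁ j)       = Adj G i j
  Adjᵛ (inj₁ i)       (inj₂ (j , _)) = i ≡ j
  Adjᵛ (inj₂ (i , _)) (inj₁ j)       = i ≡ j
  Adjᵛ (inj₂ (i , h)) (inj₂ (j , k)) = i ≡ j × Adj H h k

  adj⇒Adjᵛ : ∀ x y → Adj (G ⊙ H) x y → Adjᵛ (view x) (view y)
  adj⇒Adjᵛ x y with splitAt n x | splitAt n y
  ... | inj₁ _ | inj₁ _ = id
  ... | inj₁ _ | inj₂ _ = toWitness
  ... | inj₂ _ | inj₁ _ = toWitness
  ... | inj₂ _ | inj₂ _ = λ e → let i≡j , hk = Equivalence.to T-∧ e in toWitness i≡j , hk

  Adjᵛ⇒adj : ∀ x y → Adjᵛ (view x) (view y) → Adj (G ⊙ H) x y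
  Adjᵛ⇒adj x y with splitAt n x | splitAt n y
  ... | inj₁ _ | inj₁ _ = id
  ... | inj₁ _ | inj₂ _ = fromWitness
  ... | inj₂ _ | inj₁ _ = fromWitness
  ... | inj₂ _ | inj₂ _ = λ (i≡j , hk) → Equivalence.from T-∧ (fromWitness i≡j , hk)

  emb-adj : ∀ p q → Adjᵛ p q → Adj (G ⊙ H) (emb p) (emb q)
  emb-adj p q a =
    Adjᵛ⇒adj (emb p) (emb q) (subst₂ Adjᵛ (sym (view-emb p)) (sym (view-emb q)) a)

  adj-emb : ∀ p q → Adj (G ⊙ H) (emb p) (emb q) → Adjᵛ p q
  adj-emb p q a = subst₂ Adjᵛ (view-emb p) (view-emb q) (adj⇒Adjᵛ (emb p) (emb q) a)

  vG-adj-vH : ∀ i h → Adj (G ⊙ H) (vG i) (vH i h)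
  vG-adj-vH i h = emb-adj (inj₁ i) (inj₂ (i , h)) refl

  vH-adj-vG : ∀ i h → Adj (G ⊙ H) (vH i h) (vG i)
  vH-adj-vG i h = emb-adj (inj₂ (i , h)) (inj₁ i) refl

  vH-injective : ∀ {i j h k} → vH i h ≡ vH j k → h ≡ k
  vH-injective {i} {j} {h} {k} e = cong proj₂ (inj₂-injective (begin
    inj₂ (i , h)    ≡⟨ view-emb (inj₂ (i , h)) ⟨
    view (vH i h)   ≡⟨ cong view e ⟩
    view (vH j k)   ≡⟨ view-emb (inj₂ (j , k)) ⟩
    inj₂ (j , k)    ∎))
    where open ≡-Reasoning

  corona-loopless : Loopless G → Loopless H → Loopless (G ⊙ H)
  corona-loopless looplessG looplessH x e = no-loopᵛ (view x) (adj⇒Adjᵛ x x e)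
    where
    no-loopᵛ : ∀ p → ¬ Adjᵛ p p
    no-loopᵛ (inj₁ i)       = looplessG i
    no-loopᵛ (inj₂ (_ , h)) = looplessH h ∘ proj₂

  InCopyᵛ : Fin n → Vertex → Set
  InCopyᵛ i (inj₁ _)       = ⊥
  InCopyᵛ i (inj₂ (j , _)) = j ≡ i

  InCopy : Fin n → Fin (order (G ⊙ H)) → Set
  InCopy i x = InCopyᵛ i (view x)

  inCopy? : ∀ i x → Dec (InCopy i x)
  inCopy? i x = inCopyᵛ? (view x)
    where
    inCopyᵛ? : ∀ p → Dec (InCopyᵛ i p)
    inCopyᵛ? (inj₁ _)       = no id
    inCopyᵛ? (inj₂ (j , _)) = j ≟ i

  vH-inCopy : ∀ {i h} → InCopy i (vH i h)
  vH-inCopy {i} {h} = subst (InCopyᵛ i) (sym (view-emb (inj₂ (i , h)))) refl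

  inCopy⇒vH : ∀ {i x} → InCopy i x → ∃[ h ] x ≡ vH i h
  inCopy⇒vH {i} {x} with view x | emb-view x
  ... | inj₂ (_ , h) | e = λ { refl → h , sym e }

  enter-copy : ∀ {i w x} → Adj (G ⊙ H) w x → InCopy i x → ¬ InCopy i w → w ≡ vG i
  enter-copy {i} {w} {x} e x∈i w∉i =
    trans (sym (emb-view w)) (cong emb (enterᵛ (view w) (view x) (adj⇒Adjᵛ w x e) x∈i w∉i))
    where
    enterᵛ : ∀ p q → Adjᵛ p q → InCopyᵛ i q → ¬ InCopyᵛ i p → p ≡ inj₁ i
    enterᵛ (inj₁ _)       (inj₂ _) refl       refl _   = refl
    enterᵛ (inj₂ _)       (inj₂ _) (refl , _) refl p∉i = ⊥-elim (p∉i refl)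

  walk-into-copy : ∀ {i w x k} → ¬ InCopy i w → InCopy i x → Walk (G ⊙ H) w x k →
    ∃[ k′ ] (k′ < k × Walk (G ⊙ H) w (vG i) k′)
  walk-into-copy w∉i x∈i here = ⊥-elim (w∉i x∈i)
  walk-into-copy {i} {w} w∉i x∈i (step {y = w′} e rest) with inCopy? i w′
  ... | yes w′∈i = 0 , s≤s z≤n , subst (λ z → Walk (G ⊙ H) w z 0) (enter-copy e w′∈i w∉i) here
  ... | no  w′∉i = let k′ , k′<k , w′⇝root = walk-into-copy w′∉i x∈i rest in
                   suc k′ , s≤s k′<k , step e w′⇝root

  dist-via-root : ∀ {i w h k} → ¬ InCopy i w →
    Dist (G ⊙ H) w (vG i) k → Dist (G ⊙ H) w (vH i h) (suc k)
  dist-via-root w∉i (w⇝root , shortest) =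
    w⇝root ▷ vG-adj-vH _ _ ,
    λ K w⇝x → let k′ , k′<K , w⇝root′ = walk-into-copy w∉i vH-inCopy w⇝x in
              ≤-trans (s≤s (shortest k′ w⇝root′)) k′<K

  outside-copy-equidistant : ∀ {i w h₁ h₂ k₁ k₂} → ¬ InCopy i w →
    Dist (G ⊙ H) w (vH i h₁) k₁ → Dist (G ⊙ H) w (vH i h₂) k₂ → k₁ ≡ k₂
  outside-copy-equidistant {i} {w} w∉i d₁ d₂ =
    trans (dist-unique d₁ via-root) (dist-unique via-root d₂)
    where
    root-dist : ∃[ k ] Dist (G ⊙ H) w (vG i) k
    root-dist = walk⇒dist (proj₂ (proj₂ (walk-into-copy w∉i vH-inCopy (proj₁ d₁))))
    via-root : ∀ {h} → Dist (G ⊙ H) w (vH i h) (suc (proj₁ root-dist))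
    via-root = dist-via-root w∉i (proj₂ root-dist)

  dist-in-copy-2 : ∀ i {t x} → t ≢ x → ¬ Adj H t x → Dist (G ⊙ H) (vH i t) (vH i x) 2
  dist-in-copy-2 i t≢x ¬tx =
    dist-2 (step (vH-adj-vG i _) (step (vG-adj-vH i _) here)) (t≢x ∘ vH-injective)
           (¬tx ∘ proj₂ ∘ adj-emb (inj₂ (i , _)) (inj₂ (i , _)))

  copyOf : Subset (order (G ⊙ H)) → Fin n → Subset m
  copyOf S i = tabulate (λ h → lookup S (vH i h))

  generator⇒copy-cover : ∀ {S} → IsLocalMetricGenerator (G ⊙ H) S →
    ∀ i → NearEdgeCover H (copyOf S i)
  generator⇒copy-cover {S} generator i x y xy
    with generator (vH i x) (vH i y) (emb-adj (inj₂ (i , x)) (inj₂ (i , y)) (refl , xy))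
  ... | w , w∈S , k₁ , k₂ , d₁ , d₂ , k₁≢k₂ with inCopy? i w
  ... | no w∉i = ⊥-elim (k₁≢k₂ (outside-copy-equidistant w∉i d₁ d₂))
  ... | yes w∈i with inCopy⇒vH w∈i
  ... | t , refl with near? H t x ⊎-dec near? H t y
  ... | yes near = t , ∈-tabulate⁺ (∈⇒T-lookup w∈S) , near
  ... | no  far  = ⊥-elim (k₁≢k₂ (trans (dist-unique d₁ far-x) (dist-unique far-y d₂)))
    where
    far-x : Dist (G ⊙ H) (vH i t) (vH i x) 2
    far-x = dist-in-copy-2 i (far ∘ inj₁ ∘ inj₁) (far ∘ inj₁ ∘ inj₂)
    far-y : Dist (G ⊙ H) (vH i t) (vH i y) 2
    far-y = dist-in-copy-2 i (far ∘ inj₂ ∘ inj₁) (far ∘ inj₂ ∘ inj₂)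

  n*c≤∣S∣ : ∀ S {c} → (∀ i → c ≤ ∣ copyOf S i ∣) → n * c ≤ ∣ S ∣
  n*c≤∣S∣ S {c} copies = begin
    n * c                                          ≤⟨ ∣tabulate∣-combine≥ n (λ q → lookup S (n ↑ʳ q)) copies ⟩
    ∣ tabulate (λ q → lookup S (n ↑ʳ q)) ∣         ≤⟨ m≤n+m _ _ ⟩
    ∣ tabulate (λ i → lookup S (i ↑ˡ (n * m))) ∣ + ∣ tabulate (λ q → lookup S (n ↑ʳ q)) ∣
                                                   ≡⟨ ∣tabulate∣-↑ n (lookup S) ⟨
    ∣ tabulate (lookup S) ∣                        ≡⟨ cong ∣_∣ (tabulate∘lookup S) ⟩
    ∣ S ∣                                          ∎
    where open ≤-Reasoning

  onCopies : Subset m → Vertex → Bool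
  onCopies D (inj₁ _)       = false
  onCopies D (inj₂ (_ , h)) = lookup D h

  inEveryCopy : Subset m → Subset (order (G ⊙ H))
  inEveryCopy D = tabulate (λ x → onCopies D (view x))

  ∈-inEveryCopy : ∀ {D h} i → h ∈ D → vH i h ∈ inEveryCopy D
  ∈-inEveryCopy {D} i h∈D =
    ∈-tabulate⁺ (subst (T ∘ onCopies D) (sym (view-emb (inj₂ (i , _)))) (∈⇒T-lookup h∈D))

  ∣inEveryCopy∣ : ∀ D → ∣ inEveryCopy D ∣ ≡ n * ∣ D ∣
  ∣inEveryCopy∣ D = begin
    ∣ inEveryCopy D ∣
      ≡⟨ ∣tabulate∣-↑ n (λ x → onCopies D (view x)) ⟩
    ∣ tabulate (λ i → onCopies D (view (vG i))) ∣ + ∣ tabulate (λ q → onCopies D (view (n ↑ʳ q))) ∣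
      ≡⟨ cong₂ _+_ (∣tabulate∣≡0 _ λ i → subst (¬_ ∘ T ∘ onCopies D) (sym (view-emb (inj₁ i))) id)
                   (∣tabulate∣-combine n _ λ i → cong ∣_∣ (trans (tabulate-cong (copy i)) (tabulate∘lookup D))) ⟩
    0 + n * ∣ D ∣
      ∎
    where
    open ≡-Reasoning
    copy : ∀ i h → onCopies D (view (vH i h)) ≡ lookup D h
    copy i h = cong (onCopies D) (view-emb (inj₂ (i , h)))

  vG-∉copy : ∀ {i j} → ¬ InCopy i (vG j)
  vG-∉copy {i} {j} = subst (InCopyᵛ i) (view-emb (inj₁ j))

  vH-∉copy : ∀ {i j h} → j ≢ i → ¬ InCopy i (vH j h)
  vH-∉copy {i} {j} {h} j≢i = j≢i ∘ subst (InCopyᵛ i) (view-emb (inj₂ (j , h)))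

  lift-walk : ∀ {a b k} → Walk G a b k → Walk (G ⊙ H) (vG a) (vG b) k
  lift-walk here       = here
  lift-walk (step e w) = step (emb-adj (inj₁ _) (inj₁ _) e) (lift-walk w)

  module _ (simpleG : IsSimple G) (simpleH : IsSimple H) (triangleFree : TriangleFree H) where

    private
      loopless : Loopless (G ⊙ H)
      loopless = corona-loopless (simple⇒loopless simpleG) (simple⇒loopless simpleH)

      vH-adj-vH : ∀ i {h k} → Adj H h k → Adj (G ⊙ H) (vH i h) (vH i k)
      vH-adj-vH i hk = emb-adj (inj₂ (i , _)) (inj₂ (i , _)) (refl , hk)

    near-distinguishes : ∀ i {t x y} → Adj H x y → Near H t x →
      Distinguishes (G ⊙ H) (vH i t) (vH i x) (vH i y)
    near-distinguishes i xy (inj₁ refl) =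
      0 , 1 , dist-refl _ , dist-adj loopless (vH-adj-vH i xy) , λ ()
    near-distinguishes i {t} {x} {y} xy (inj₂ tx) with t ≟ y
    ... | yes refl = 1 , 0 , dist-adj loopless (vH-adj-vH i tx) , dist-refl _ , λ ()
    ... | no  t≢y  = 1 , 2 , dist-adj loopless (vH-adj-vH i tx) ,
                     dist-in-copy-2 i t≢y (λ ty → triangleFree tx xy (adj-sym simpleH ty)) , λ ()

    cover⇒generator : Connected G → 2 ≤ n → ∀ {D t₀} → t₀ ∈ D → NearEdgeCover H D →
      IsLocalMetricGenerator (G ⊙ H) (inEveryCopy D)
    cover⇒generator connected 2≤n {D} {t₀} t₀∈D cover x y xy =
      subst₂ (λ x′ y′ → ∃[ w ] (w ∈ inEveryCopy D × Distinguishes (G ⊙ H) w x′ y′))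
        (emb-view x) (emb-view y) (distinguish (view x) (view y) (adj⇒Adjᵛ x y xy))
      where
      Distinguished : Vertex → Vertex → Set
      Distinguished p q = ∃[ w ] (w ∈ inEveryCopy D × Distinguishes (G ⊙ H) w (emb p) (emb q))

      distinguish : ∀ p q → Adjᵛ p q → Distinguished p q
      distinguish (inj₁ a) (inj₁ b) ab =
        vH a t₀ , ∈-inEveryCopy a t₀∈D ,
        1 , 2 , dist-adj loopless (vH-adj-vG a t₀) ,
        dist-2 (step (vH-adj-vG a t₀) (step (emb-adj (inj₁ a) (inj₁ b) ab) here))
               (λ e → vG-∉copy (subst (InCopy a) e vH-inCopy))
               (λ e → adj⇒≢ (simple⇒loopless simpleG) ab (adj-emb (inj₂ (a , t₀)) (inj₁ b) e)) ,
        λ ()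
      distinguish (inj₁ a) (inj₂ (_ , h)) refl =
        let j , j≢a = ∃-other 2≤n a
            k , w⇝a = walk⇒dist (step (vH-adj-vG j t₀) (lift-walk (proj₂ (connected j a))))
        in vH j t₀ , ∈-inEveryCopy j t₀∈D ,
           k , suc k , w⇝a , dist-via-root (vH-∉copy j≢a) w⇝a , 1+n≢n ∘ sym
      distinguish (inj₂ (i , h)) (inj₁ _) refl =
        let w , w∈ , d = distinguish (inj₁ i) (inj₂ (i , h)) refl in w , w∈ , distinguishes-sym d
      distinguish (inj₂ (i , x)) (inj₂ (_ , y)) (refl , xy) with cover x y xy
      ... | t , t∈D , inj₁ tx = vH i t , ∈-inEveryCopy i t∈D , near-distinguishes i xy tx
      ... | t , t∈D , inj₂ ty = vH i t , ∈-inEveryCopy i t∈D ,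
                                distinguishes-sym (near-distinguishes i (adj-sym simpleH xy) ty)

mainTheorem7 : (H : Graph) → IsSimple H → Bipartite H → Diameter H 3 → Girth H 6
    → (∀ t → 3 ≤ t → ¬ Isomorphic H (pseudoSphere t))
    → (G : Graph) → IsSimple G → Connected G → 2 ≤ order G
    → (δ : ℕ) → MinDegree H δ
    → LocalMetricDim (G ⊙ H) (order G * δ)
mainTheorem7 H simpleH bipartite diameter girth _ G simpleG connected 2≤n δ (minDegree , v , degree≡δ) =
  (inEveryCopy (neighbours H v) , generator , trans (∣inEveryCopy∣ _) (cong (order G *_) degree≡δ)) ,
  λ S generator′ → n*c≤∣S∣ S λ i →
    nearEdgeCover⇒δ≤∣D∣ simpleH triangleFree squareFree minDegree v (generator⇒copy-cover generator′ i)
  where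
  open Corona G H
  triangleFree : TriangleFree H
  triangleFree = girth>3⇒triangleFree simpleH girth (s≤s (s≤s (s≤s (s≤s z≤n))))

  squareFree : SquareFree H
  squareFree = girth>4⇒squareFree simpleH girth (s≤s (s≤s (s≤s (s≤s (s≤s z≤n)))))

  cover : NearEdgeCover H (neighbours H v)
  cover = bipartite⇒neighbours-cover simpleH bipartite
            (λ x y → let k , k≤3 , d = proj₁ diameter x y in k , k≤3 , proj₁ d) v

  -- N(v) is nonempty because it covers an edge of H, the first edge of a path of length 3.
  generator : IsLocalMetricGenerator (G ⊙ H) (inEveryCopy (neighbours H v))
  generator with proj₂ diameter
  ... | x , _ , step xy _ , _ with cover x _ xy
  ...   | s , s∈N[v] , _ = cover⇒generator simpleG simpleH triangleFree connected 2≤n s∈N[v] cover
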